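{- Let $m\ge 3$, $n \ge 3$, and let $f$ be a 2RDF of $C_m \Box C_n$ of minimum weight $\gamma_{r2}(C_m\Box C_n)$. Write $m = 3k + \ell$ with $\ell \in\{0,1,2\}$. For each column index $i$ (indices taken modulo $n$) let $s_i=\sum_{x\in \mathcal{C}^i}|f(x)|$. Then for every $i$: (a) $s_{i-1}+s_{i+1} \geq 2m - 4s_{i} = 6k + 2\ell - 4s_{i}$; (b) if $k \ge s_{\min} := \min \{ s_{i-1}, s_{i+1}\}$, then $s_{\max} \geq 2m - 4s_{i} - s_{\min} \ge 5k + 2\ell - 4s_{i}$, where $s_{\max} = \max \{ s_{i-1}, s_{i+1}\}$.
   Context: A 2-rainbow dominating function (2RDF) of a graph $G$ assigns to each vertex a subset of $\{1,2\}$ so that every vertex $v$ with $f(v)=\emptyset$ satisfies $\bigcup_{u\in N(v)} f(u)=\{1,2\}$; its weight is $\sum_v |f(v)|$ and $\gamma_{r2}(G)$ is the minimum weight. The vertices of $C_m\Box C_n$ are $(a,j)$ with $a \in \{1,\dots,m\}$, $j\in\{1,\dots,n\}$ (coordinates taken mod $m$ and mod $n$), $(a,j)\sim(a',j')$ iff ($a=a'$ and $j-j'\equiv \pm1 \pmod n$) or ($j=j'$ and $a-a'\equiv\pm1\pmod m$). The $i$-th column is $\mathcal{C}^i=\{(1,i),(2,i),\dots,(m,i)\}$, $i\in\{1,\dots,n\}$, which induces a copy of $C_m$. -}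

module Defs where

open import Data.Nat using (ℕ; suc; _+_; _≤_)
open import Data.Nat.DivMod using (_%_; m%n<n)
open import Data.Fin using (Fin; toℕ; fromℕ<)
open import Data.Fin.Subset using (Subset; ⊥; _∈_; ∣_∣)
open import Data.List using (List; map; allFin)
open import Data.Nat.ListAction using (sum)
open import Data.Product using (_×_; Σ; ∃)
open import Data.Sum using (_⊎_)
open import Relation.Binary.PropositionalEquality using (_≡_)

next : ∀ {n} → Fin n → Fin n
next {suc n} i = fromℕ< (m%n<n (suc (toℕ i)) (suc n))

prev : ∀ {n} → Fin n → Fin n
prev {suc n} i = fromℕ< (m%n<n (toℕ i + n) (suc n))

-- vertex (a , j) of C_m □ C_n : a ∈ Fin m (row), j ∈ Fin n (column)
-- adjacency in the Cartesian product C_m □ C_n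
Adj : ∀ {m n} → Fin m → Fin n → Fin m → Fin n → Set
Adj a j a' j' =
  (a ≡ a' × (j' ≡ next j ⊎ j' ≡ prev j)) ⊎
  (j ≡ j' × (a' ≡ next a ⊎ a' ≡ prev a))

Labeling : ℕ → ℕ → Set
Labeling m n = Fin m → Fin n → Subset 2

Is2RDF : ∀ {m n} → Labeling m n → Set
Is2RDF {m} {n} f =
  ∀ (a : Fin m) (j : Fin n) → f a j ≡ ⊥ →
    ∀ (c : Fin 2) → Σ (Fin m) λ a' → Σ (Fin n) λ j' →
      Adj a j a' j' × c ∈ f a' j'

weight : ∀ {m n} → Labeling m n → ℕ
weight {m} {n} f = sum (map (λ a → sum (map (λ j → ∣ f a j ∣) (allFin n))) (allFin m))

IsMin2RDF : ∀ {m n} → Labeling m n → Set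
IsMin2RDF {m} {n} f = Is2RDF f × (∀ (g : Labeling m n) → Is2RDF g → weight f ≤ weight g)

colSum : ∀ {m n} → Labeling m n → Fin n → ℕ
colSum {m} f i = sum (map (λ a → ∣ f a i ∣) (allFin m))

-- For a fixed column i and any row a, either f(a,i) ≠ ∅ or the labels of the four
-- neighbours of (a,i) cover {1,2}; in both cases
--   |f(a,i-1)| + |f(a,i+1)| + |f(a-1,i)| + |f(a+1,i)| + 2|f(a,i)| ≥ 2.
-- Summing over the rows, and using that a ↦ a ± 1 permutes them, gives
-- s_{i-1} + s_{i+1} + 4 s_i ≥ 2m. Part (b) follows from s_{i-1} + s_{i+1} = s_min + s_max
-- and 2m = 6k + 2ℓ ≥ 5k + 2ℓ + s_min.

module Submission where

open import Defs
open import Data.Nat using (ℕ; _≤_; _<_; _⊓_; _⊔_)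
open import Data.Integer using (+_; _-_) renaming (_≤_ to _≤ℤ_)
open import Data.Fin using (Fin)
open import Data.Product using (_×_)
open import Relation.Binary.PropositionalEquality using (_≡_)
open import Data.Nat as ℕ using ()

open import Data.Fin using (zero; suc; toℕ)
open import Data.Fin.Permutation using (permutation)
open import Data.Fin.Properties using (toℕ-injective; toℕ-fromℕ<; toℕ<n)
open import Data.Fin.Subset using (Subset; _∪_; ⊤; _∈_; ∣_∣; inside; outside)
open import Data.Fin.Subset.Properties
  using (p⊆q⇒∣p∣≤∣q∣; ∣⊤∣≡n; ∣p∣≤∣x∷p∣; x∈p∪q⁺; nonempty?; Empty-unique; x∈p⇒∣p-x∣<∣p∣)
open import Data.Integer using (ℤ; +≤+; -_) renaming (_+_ to _+ℤ_)
import Data.Integer.Properties as ℤ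
open import Algebra.Properties.AbelianGroup ℤ.+-0-abelianGroup using (//-rightDividesʳ)
open import Algebra.Properties.CommutativeSemigroup ℤ.+-commutativeSemigroup using (xy∙z≈xz∙y)
open import Data.List using (map; allFin; tabulate)
open import Data.List.Properties using (map-tabulate)
open import Data.Nat using (zero; suc; _+_; _*_; z≤n; s≤s; NonZero)
open import Data.Nat.DivMod using (_%_; %-distribˡ-+; m%n%n≡m%n; [m+n]%n≡m%n; m<n⇒m%n≡m; m%n<n)
open import Data.Nat.ListAction using (sum)
open import Data.Nat.Properties
open import Algebra.Properties.Semiring.Sum +-*-semiring using (sum-syntax; ∑-distrib-+; ∑-permute; *-distribˡ-sum)
open import Data.Nat.Tactic.RingSolver using (solve-∀)
open import Data.Product using (_,_)
open import Data.Sum using (inj₁; inj₂)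
open import Data.Vec using ([]; _∷_)
open import Data.Vec.Functional using (Vector)
open import Function using (_∘_; id)
open import Relation.Binary.PropositionalEquality
  using (refl; sym; trans; cong; cong₂; subst; module ≡-Reasoning)
open import Relation.Nullary using (yes; no)

[m+n%d]%d≡[m+n]%d : ∀ m n d .{{_ : NonZero d}} → (m + n % d) % d ≡ (m + n) % d
[m+n%d]%d≡[m+n]%d m n d = begin
  (m + n % d) % d           ≡⟨ %-distribˡ-+ m (n % d) d ⟩
  (m % d + n % d % d) % d   ≡⟨ cong (λ x → (m % d + x) % d) (m%n%n≡m%n n d) ⟩
  (m % d + n % d) % d       ≡⟨ %-distribˡ-+ m n d ⟨
  (m + n) % d               ∎
  where open ≡-Reasoning

[i+n]%n≡i : ∀ {n} (i : Fin (suc n)) → (toℕ i + suc n) % suc n ≡ toℕ i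
[i+n]%n≡i {n} i = trans ([m+n]%n≡m%n (toℕ i) (suc n)) (m<n⇒m%n≡m (toℕ<n i))

next-prev : ∀ {n} (i : Fin n) → next (prev i) ≡ i
next-prev {suc n} i = toℕ-injective (begin
  toℕ (next (prev i))                   ≡⟨ toℕ-fromℕ< _ ⟩
  suc (toℕ (prev i)) % suc n            ≡⟨ cong (λ x → suc x % suc n) (toℕ-fromℕ< _) ⟩
  (1 + (toℕ i + n) % suc n) % suc n     ≡⟨ [m+n%d]%d≡[m+n]%d 1 (toℕ i + n) (suc n) ⟩
  suc (toℕ i + n) % suc n               ≡⟨ cong (_% suc n) (+-suc (toℕ i) n) ⟨
  (toℕ i + suc n) % suc n               ≡⟨ [i+n]%n≡i i ⟩
  toℕ i                                 ∎)
  where open ≡-Reasoning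

prev-next : ∀ {n} (i : Fin n) → prev (next i) ≡ i
prev-next {suc n} i = toℕ-injective (begin
  toℕ (prev (next i))                   ≡⟨ toℕ-fromℕ< _ ⟩
  (toℕ (next i) + n) % suc n            ≡⟨ cong (λ x → (x + n) % suc n) (toℕ-fromℕ< (m%n<n (suc (toℕ i)) (suc n))) ⟩
  (suc (toℕ i) % suc n + n) % suc n     ≡⟨ cong (_% suc n) (+-comm _ n) ⟩
  (n + suc (toℕ i) % suc n) % suc n     ≡⟨ [m+n%d]%d≡[m+n]%d n (suc (toℕ i)) (suc n) ⟩
  (n + suc (toℕ i)) % suc n             ≡⟨ cong (_% suc n) (+-comm n (suc (toℕ i))) ⟩
  suc (toℕ i + n) % suc n               ≡⟨ cong (_% suc n) (+-suc (toℕ i) n) ⟨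
  (toℕ i + suc n) % suc n               ≡⟨ [i+n]%n≡i i ⟩
  toℕ i                                 ∎)
  where open ≡-Reasoning

sum-map-allFin : ∀ {n} (g : Vector ℕ n) → sum (map g (allFin n)) ≡ ∑[ a < n ] g a
sum-map-allFin g = trans (cong sum (map-tabulate id g)) (sum-tabulate g)
  where
  sum-tabulate : ∀ {n} (g : Vector ℕ n) → sum (tabulate g) ≡ ∑[ a < n ] g a
  sum-tabulate {zero}  g = refl
  sum-tabulate {suc n} g = cong (λ s → g zero + s) (sum-tabulate (g ∘ suc))

∑-const : ∀ n x → ∑[ _ < n ] x ≡ n * x
∑-const zero    x = refl
∑-const (suc n) x = cong (λ s → x + s) (∑-const n x)

∑-mono-≤ : ∀ {n} {g h : Vector ℕ n} → (∀ a → g a ≤ h a) → ∑[ a < n ] g a ≤ ∑[ a < n ] h a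
∑-mono-≤ {zero}  g≤h = z≤n
∑-mono-≤ {suc n} g≤h = +-mono-≤ (g≤h zero) (∑-mono-≤ (g≤h ∘ suc))

∑-reindex : ∀ {n} (g : Vector ℕ n) {σ τ : Fin n → Fin n} →
            (∀ a → σ (τ a) ≡ a) → (∀ a → τ (σ a) ≡ a) →
            ∑[ a < n ] g (σ a) ≡ ∑[ a < n ] g a
∑-reindex g σ∘τ τ∘σ = sym (∑-permute g (permutation _ _ σ∘τ τ∘σ))

∑-prev : ∀ {n} (g : Vector ℕ n) → ∑[ a < n ] g (prev a) ≡ ∑[ a < n ] g a
∑-prev g = ∑-reindex g prev-next next-prev

∑-next : ∀ {n} (g : Vector ℕ n) → ∑[ a < n ] g (next a) ≡ ∑[ a < n ] g a
∑-next g = ∑-reindex g next-prev prev-next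

∣p∪q∣≤∣p∣+∣q∣ : ∀ {n} (p q : Subset n) → ∣ p ∪ q ∣ ≤ ∣ p ∣ + ∣ q ∣
∣p∪q∣≤∣p∣+∣q∣ []            []            = z≤n
∣p∪q∣≤∣p∣+∣q∣ (outside ∷ p) (outside ∷ q) = ∣p∪q∣≤∣p∣+∣q∣ p q
∣p∪q∣≤∣p∣+∣q∣ (outside ∷ p) (inside  ∷ q) =
  subst (suc ∣ p ∪ q ∣ ≤_) (sym (+-suc ∣ p ∣ ∣ q ∣)) (s≤s (∣p∪q∣≤∣p∣+∣q∣ p q))
∣p∪q∣≤∣p∣+∣q∣ (inside  ∷ p) (y       ∷ q) =
  s≤s (≤-trans (∣p∪q∣≤∣p∣+∣q∣ p q) (+-monoʳ-≤ ∣ p ∣ (∣p∣≤∣x∷p∣ y q)))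

⊤⊆p⇒n≤∣p∣ : ∀ {n} {p : Subset n} → (∀ x → x ∈ p) → n ≤ ∣ p ∣
⊤⊆p⇒n≤∣p∣ {n} {p} ⊤⊆p = subst (_≤ ∣ p ∣) (∣⊤∣≡n n) (p⊆q⇒∣p∣≤∣q∣ {p = ⊤} (λ {x} _ → ⊤⊆p x))

x∈p⇒1≤∣p∣ : ∀ {n} {p : Subset n} {x} → x ∈ p → 1 ≤ ∣ p ∣
x∈p⇒1≤∣p∣ x∈p = <-≤-trans (s≤s z≤n) (x∈p⇒∣p-x∣<∣p∣ x∈p)

neighbourLabels : ∀ {m n} → Labeling m n → Fin m → Fin n → Subset 2
neighbourLabels f a j = f a (prev j) ∪ f a (next j) ∪ f (prev a) j ∪ f (next a) j

neighbourWeight : ∀ {m n} → Labeling m n → Fin m → Fin n → ℕ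
neighbourWeight f a j =
  (∣ f a (prev j) ∣ + ∣ f a (next j) ∣) + (∣ f (prev a) j ∣ + ∣ f (next a) j ∣)

∈-neighbourLabels : ∀ {m n} (f : Labeling m n) {a a' j j' c} →
                    Adj a j a' j' → c ∈ f a' j' → c ∈ neighbourLabels f a j
∈-neighbourLabels f (inj₁ (refl , inj₂ refl)) c∈ = x∈p∪q⁺ (inj₁ c∈)
∈-neighbourLabels f (inj₁ (refl , inj₁ refl)) c∈ = x∈p∪q⁺ (inj₂ (x∈p∪q⁺ (inj₁ c∈)))
∈-neighbourLabels f (inj₂ (refl , inj₂ refl)) c∈ = x∈p∪q⁺ (inj₂ (x∈p∪q⁺ (inj₂ (x∈p∪q⁺ (inj₁ c∈)))))
∈-neighbourLabels f (inj₂ (refl , inj₁ refl)) c∈ = x∈p∪q⁺ (inj₂ (x∈p∪q⁺ (inj₂ (x∈p∪q⁺ (inj₂ c∈)))))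

∣neighbourLabels∣≤neighbourWeight : ∀ {m n} (f : Labeling m n) a j →
                                    ∣ neighbourLabels f a j ∣ ≤ neighbourWeight f a j
∣neighbourLabels∣≤neighbourWeight f a j = begin
  ∣ W ∪ E ∪ N ∪ S ∣                     ≤⟨ ∣p∪q∣≤∣p∣+∣q∣ W (E ∪ N ∪ S) ⟩
  ∣ W ∣ + ∣ E ∪ N ∪ S ∣                 ≤⟨ +-monoʳ-≤ ∣ W ∣ (∣p∪q∣≤∣p∣+∣q∣ E (N ∪ S)) ⟩
  ∣ W ∣ + (∣ E ∣ + ∣ N ∪ S ∣)           ≤⟨ +-monoʳ-≤ ∣ W ∣ (+-monoʳ-≤ ∣ E ∣ (∣p∪q∣≤∣p∣+∣q∣ N S)) ⟩
  ∣ W ∣ + (∣ E ∣ + (∣ N ∣ + ∣ S ∣))     ≡⟨ +-assoc ∣ W ∣ ∣ E ∣ _ ⟨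
  (∣ W ∣ + ∣ E ∣) + (∣ N ∣ + ∣ S ∣)     ∎
  where
  open ≤-Reasoning
  W E N S : Subset 2
  W = f a (prev j)
  E = f a (next j)
  N = f (prev a) j
  S = f (next a) j

rainbow-local-bound : ∀ {m n} {f : Labeling m n} → Is2RDF f →
                      ∀ a j → 2 ≤ neighbourWeight f a j + 2 * ∣ f a j ∣
rainbow-local-bound {f = f} rainbow a j with nonempty? (f a j)
... | yes (_ , x∈faj) = ≤-trans (*-monoʳ-≤ 2 (x∈p⇒1≤∣p∣ x∈faj)) (m≤n+m _ (neighbourWeight f a j))
... | no  faj-empty   = ≤-trans neighbours-see-both (m≤m+n _ _)
  where
  neighbours-see-both : 2 ≤ neighbourWeight f a j
  neighbours-see-both = ≤-trans
    (⊤⊆p⇒n≤∣p∣ λ c → let (_ , _ , adj , c∈) = rainbow a j (Empty-unique faj-empty) c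
                     in ∈-neighbourLabels f adj c∈)
    (∣neighbourLabels∣≤neighbourWeight f a j)

colSum≡∑ : ∀ {m n} (f : Labeling m n) i → colSum f i ≡ ∑[ a < m ] ∣ f a i ∣
colSum≡∑ f i = sum-map-allFin (λ a → ∣ f a i ∣)

∑-neighbourWeight : ∀ {m n} (f : Labeling m n) i →
                    ∑[ a < m ] neighbourWeight f a i ≡
                    (colSum f (prev i) + colSum f (next i)) + (colSum f i + colSum f i)
∑-neighbourWeight {m} f i = begin
  ∑[ a < m ] ((W a + E a) + (C (prev a) + C (next a)))
    ≡⟨ ∑-distrib-+ (λ a → W a + E a) (λ a → C (prev a) + C (next a)) ⟩
  ∑[ a < m ] (W a + E a) + ∑[ a < m ] (C (prev a) + C (next a))
    ≡⟨ cong₂ _+_ (∑-distrib-+ W E) (∑-distrib-+ (C ∘ prev) (C ∘ next)) ⟩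
  (∑[ a < m ] W a + ∑[ a < m ] E a) + (∑[ a < m ] C (prev a) + ∑[ a < m ] C (next a))
    ≡⟨ cong₂ _+_ (cong₂ _+_ (sym (colSum≡∑ f (prev i))) (sym (colSum≡∑ f (next i))))
                 (cong₂ _+_ (trans (∑-prev C) (sym (colSum≡∑ f i)))
                            (trans (∑-next C) (sym (colSum≡∑ f i)))) ⟩
  (colSum f (prev i) + colSum f (next i)) + (colSum f i + colSum f i)
    ∎
  where
  open ≡-Reasoning
  W E C : Vector ℕ m
  W a = ∣ f a (prev i) ∣
  E a = ∣ f a (next i) ∣
  C a = ∣ f a i ∣

column-bound : ∀ {m n} {f : Labeling m n} → Is2RDF f → ∀ i →
               2 * m ≤ (colSum f (prev i) + colSum f (next i)) + 4 * colSum f i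
column-bound {m} {f = f} rainbow i = begin
  2 * m
    ≡⟨ trans (*-comm 2 m) (sym (∑-const m 2)) ⟩
  ∑[ _ < m ] 2
    ≤⟨ ∑-mono-≤ (λ a → rainbow-local-bound rainbow a i) ⟩
  ∑[ a < m ] (neighbourWeight f a i + 2 * C a)
    ≡⟨ ∑-distrib-+ (λ a → neighbourWeight f a i) (λ a → 2 * C a) ⟩
  ∑[ a < m ] neighbourWeight f a i + ∑[ a < m ] (2 * C a)
    ≡⟨ cong₂ _+_ (∑-neighbourWeight f i) (sym (*-distribˡ-sum 2 C)) ⟩
  (p + q) + (s + s) + 2 * ∑[ a < m ] C a
    ≡⟨ cong (λ x → (p + q) + (s + s) + 2 * x) (colSum≡∑ f i) ⟨
  (p + q) + (s + s) + 2 * s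
    ≡⟨ +-assoc (p + q) (s + s) (2 * s) ⟩
  (p + q) + ((s + s) + 2 * s)
    ≡⟨ cong (λ x → (p + q) + x) (x+x+2x≡4x s) ⟩
  (p + q) + 4 * s
    ∎
  where
  open ≤-Reasoning
  C : Vector ℕ m
  C a = ∣ f a i ∣
  p q s : ℕ
  p = colSum f (prev i)
  q = colSum f (next i)
  s = colSum f i
  x+x+2x≡4x : ∀ x → x + x + 2 * x ≡ 4 * x
  x+x+2x≡4x = solve-∀

i≤j+k⇒i-k≤j : ∀ {i j k : ℤ} → i ≤ℤ j +ℤ k → i - k ≤ℤ j
i≤j+k⇒i-k≤j {i} {j} {k} i≤j+k = begin
  i - k         ≤⟨ ℤ.+-monoˡ-≤ (- k) i≤j+k ⟩
  j +ℤ k - k    ≡⟨ //-rightDividesʳ k j ⟩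
  j             ∎
  where open ℤ.≤-Reasoning

i+k≤j⇒i≤j-k : ∀ {i j k : ℤ} → i +ℤ k ≤ℤ j → i ≤ℤ j - k
i+k≤j⇒i≤j-k {i} {j} {k} i+k≤j = begin
  i             ≡⟨ //-rightDividesʳ k i ⟨
  i +ℤ k - k    ≤⟨ ℤ.+-monoˡ-≤ (- k) i+k≤j ⟩
  j - k         ∎
  where open ℤ.≤-Reasoning

m+n≡m⊔n+m⊓n : ∀ m n → m + n ≡ m ⊔ n + m ⊓ n
m+n≡m⊔n+m⊓n m n with ≤-total m n
... | inj₁ m≤n rewrite m≤n⇒m⊔n≡n m≤n | m≤n⇒m⊓n≡m m≤n = +-comm m n
... | inj₂ n≤m rewrite m≥n⇒m⊔n≡m n≤m | m≥n⇒m⊓n≡n n≤m = refl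

i≤m+n⇒i-m⊓n≤m⊔n : ∀ {i} m n → i ≤ℤ + (m + n) → i - + (m ⊓ n) ≤ℤ + (m ⊔ n)
i≤m+n⇒i-m⊓n≤m⊔n {i} m n i≤m+n = i≤j+k⇒i-k≤j {i} {+ (m ⊔ n)} {+ (m ⊓ n)}
  (subst (λ x → i ≤ℤ + x) (m+n≡m⊔n+m⊓n m n) i≤m+n)

2[3k+ℓ]≡6k+2ℓ : ∀ k ℓ → 2 * (3 * k + ℓ) ≡ 6 * k + 2 * ℓ
2[3k+ℓ]≡6k+2ℓ = solve-∀

t≤k⇒5k+2ℓ+t≤2[3k+ℓ] : ∀ {k t} ℓ → t ≤ k → 5 * k + 2 * ℓ + t ≤ 2 * (3 * k + ℓ)
t≤k⇒5k+2ℓ+t≤2[3k+ℓ] {k} {t} ℓ t≤k =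
  subst (5 * k + 2 * ℓ + t ≤_) (5k+2ℓ+k≡2[3k+ℓ] k ℓ) (+-monoʳ-≤ (5 * k + 2 * ℓ) t≤k)
  where
  5k+2ℓ+k≡2[3k+ℓ] : ∀ k ℓ → 5 * k + 2 * ℓ + k ≡ 2 * (3 * k + ℓ)
  5k+2ℓ+k≡2[3k+ℓ] = solve-∀

lemma2 : (m n : ℕ) → 3 ≤ m → 3 ≤ n → (f : Labeling m n) → IsMin2RDF f →
         (k ℓ : ℕ) → ℓ < 3 → m ≡ 3 ℕ.* k ℕ.+ ℓ → (i : Fin n) →
         ((+ (2 ℕ.* m) - + (4 ℕ.* colSum f i) ≤ℤ + (colSum f (prev i) ℕ.+ colSum f (next i)))
           × (+ (2 ℕ.* m) - + (4 ℕ.* colSum f i) ≡ + (6 ℕ.* k ℕ.+ 2 ℕ.* ℓ) - + (4 ℕ.* colSum f i)))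
         × (colSum f (prev i) ⊓ colSum f (next i) ≤ k →
            (+ (2 ℕ.* m) - + (4 ℕ.* colSum f i) - + (colSum f (prev i) ⊓ colSum f (next i))
               ≤ℤ + (colSum f (prev i) ⊔ colSum f (next i)))
            × (+ (5 ℕ.* k ℕ.+ 2 ℕ.* ℓ) - + (4 ℕ.* colSum f i)
               ≤ℤ + (2 ℕ.* m) - + (4 ℕ.* colSum f i) - + (colSum f (prev i) ⊓ colSum f (next i))))
lemma2 _ _ _ _ f (rainbow , _) k ℓ _ refl i =
  (part-a , cong (λ x → + x - + (4 * s)) (2[3k+ℓ]≡6k+2ℓ k ℓ)) ,
  λ p⊓q≤k → i≤m+n⇒i-m⊓n≤m⊔n p q part-a , part-b p⊓q≤k
  where
  s p q : ℕ
  s = colSum f i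
  p = colSum f (prev i)
  q = colSum f (next i)

  part-a : + (2 * (3 * k + ℓ)) - + (4 * s) ≤ℤ + (p + q)
  part-a = i≤j+k⇒i-k≤j {k = + (4 * s)} (+≤+ (column-bound rainbow i))

  part-b : p ⊓ q ≤ k → + (5 * k + 2 * ℓ) - + (4 * s) ≤ℤ + (2 * (3 * k + ℓ)) - + (4 * s) - + (p ⊓ q)
  part-b p⊓q≤k = begin
    + (5 * k + 2 * ℓ) - + (4 * s)
      ≤⟨ ℤ.+-monoˡ-≤ (- + (4 * s)) (i+k≤j⇒i≤j-k {i = + (5 * k + 2 * ℓ)} {k = + (p ⊓ q)}
                                      (+≤+ (t≤k⇒5k+2ℓ+t≤2[3k+ℓ] ℓ p⊓q≤k))) ⟩
    + (2 * (3 * k + ℓ)) - + (p ⊓ q) - + (4 * s)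
      ≡⟨ xy∙z≈xz∙y (+ (2 * (3 * k + ℓ))) (- + (p ⊓ q)) (- + (4 * s)) ⟩
    + (2 * (3 * k + ℓ)) - + (4 * s) - + (p ⊓ q)
      ∎
    where open ℤ.≤-Reasoning
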